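{- Let $S$ be a ssyt with entries in $[n]$ whose shape has $p$ nonzero parts, and let $\varphi=\varphi_1\dots\varphi_n\in\mathfrak S_n$ be the permutation produced from $S$ by the push-down procedure described in the context. Let $q$ be the number of boxes in the last column of $S$. Then $\varphi_1,\dots,\varphi_q$ are exactly the entries of the last column of $S$, in the same order (top to bottom).
   Context: Push-down procedure: a configuration is an arrangement of entries in boxes of a grid (positions matter; some boxes may be empty). Put $S_1:=S$, and let $\mathbf e_1$ be the rightmost entry of row 1; $\varphi_1$ is its value. For $i=2,\dots,p$: starting from $S_{i-1}$, let the temporarily exposed entry $\mathbf e'$ be the rightmost entry in row $i$. Repeat: look at the row immediately above that of $\mathbf e'$; if it contains an entry whose value is $\ge$ the value of $\mathbf e'$, let $\mathbf c$ be the leftmost such entry, move $\mathbf c$ and all entries to its right in its row one row down (same columns), and redesignate $\mathbf e'$ to be the entry immediately to the left of the former position of $\mathbf c$; otherwise stop. The resulting configuration is $S_i$, the final $\mathbf e'$ is $\mathbf e_i$, and $\varphi_i$ is its value. Then $\varphi_{p+1},\dots,\varphi_n$ are the elements of $[n]\setminus\{\varphi_1,\dots,\varphi_p\}$ in increasing order. -}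

module Defs where

open import Data.Nat using (ℕ; zero; suc; _≤_; _<_; _∸_; _≤?_; _≟_)
open import Data.Bool using (Bool; true; false)
open import Data.Maybe using (Maybe; just; nothing; _<∣>_)
open import Data.Product using (_×_; _,_)
open import Data.List using (List; []; _∷_; length; map; filter; upTo; _++_)
open import Data.List.Relation.Unary.All using (All)
open import Data.List.Relation.Unary.Linked using (Linked)
open import Data.List.Membership.DecPropositional _≟_ using (_∈?_)
open import Data.Unit using (⊤)
open import Data.Empty using (⊥)
open import Relation.Nullary using (¬?; yes; no)
open import Relation.Binary.PropositionalEquality using (_≢_)

-- Tableaux: a tableau is the list of its rows (top to bottom), each row
-- a list of entries (left to right).  English convention.

StrictBelow : List ℕ → List ℕ → Set
StrictBelow _        []       = ⊤
StrictBelow []       (_ ∷ _)  = ⊥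
StrictBelow (a ∷ as) (b ∷ bs) = (a < b) × StrictBelow as bs

-- Semistandard Young tableau with entries in [n] = {1,…,n}; all rows are
-- nonempty, so the number of nonzero parts p of the shape is `length T`.
record IsSSYT (n : ℕ) (T : List (List ℕ)) : Set where
  field
    rowsNonempty : All (λ r → r ≢ []) T
    entriesInRange : All (All (λ x → (1 ≤ x) × (x ≤ n))) T
    rowsWeak : All (Linked _≤_) T
    colsStrict : Linked StrictBelow T

-- Configurations: partial fillings of the grid; rows and columns are
-- 0-indexed (row 0 = row 1 of the paper).

Config : Set
Config = ℕ → ℕ → Maybe ℕ

nth : {A : Set} → List A → ℕ → Maybe A
nth []       _       = nothing
nth (x ∷ _)  zero    = just x
nth (_ ∷ xs) (suc k) = nth xs k

toConfig : List (List ℕ) → Config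
toConfig T r c with nth T r
... | nothing  = nothing
... | just row = nth row c

rightmost : Config → ℕ → ℕ → Maybe (ℕ × ℕ)
rightmost f r zero = nothing
rightmost f r (suc k) with f r k
... | just v  = just (k , v)
... | nothing = rightmost f r k

leftmostGE : Config → ℕ → ℕ → ℕ → ℕ → Maybe (ℕ × ℕ)
leftmostGE f r v c zero = nothing
leftmostGE f r v c (suc k) with f r c
... | nothing = leftmostGE f r v (suc c) k
... | just w with v ≤? w
...   | yes _ = just (c , w)
...   | no  _ = leftmostGE f r v (suc c) k

shift : Config → ℕ → ℕ → Config
shift f r c r' c' with c ≤? c'
... | no _ = f r' c'
... | yes _ with r' ≟ r
...   | yes _ = nothing
...   | no _ with r' ≟ suc r
...     | yes _ = f r c' <∣> f r' c'
...     | no _  = f r' c'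

-- Arguments: width bound W
-- (all entries lie in columns < W), current configuration, row of the
-- current entry e', value of e'.  Returns final configuration and the value
-- of the final e'.  (Convention: value 0, which is not in [n], marks an
-- undefined entry.)
loop : ℕ → Config → ℕ → ℕ → Config × ℕ
loop W f zero v = f , v
loop W f (suc r) v with leftmostGE f r v 0 W
... | nothing = f , v
... | just (c , _) with rightmost f r c
...   | nothing = shift f r c , 0
...   | just (_ , v') = loop W (shift f r c) r v'

-- Step i (0-indexed row i): expose the rightmost entry of row i, then loop.
-- For row 0 this just returns the rightmost entry of row 1 (paper's e₁).
step : ℕ → Config → ℕ → Config × ℕ
step W f i with rightmost f i W
... | nothing = f , 0
... | just (_ , v) = loop W f i v

-- values of e_{i+1}, …, e_{i+k}
steps : ℕ → Config → ℕ → ℕ → List ℕ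
steps W f i zero = []
steps W f i (suc k) with step W f i
... | f' , v = v ∷ steps W f' (suc i) k

firstRowLength : List (List ℕ) → ℕ
firstRowLength []      = 0
firstRowLength (r ∷ _) = length r

pushDownPrefix : List (List ℕ) → List ℕ
pushDownPrefix T = steps (firstRowLength T) (toConfig T) 0 (length T)

pushDown : ℕ → List (List ℕ) → List ℕ
pushDown n T =
  pushDownPrefix T ++ filter (λ x → ¬? (x ∈? pushDownPrefix T)) (map suc (upTo n))

columnFrom : Config → ℕ → ℕ → ℕ → List ℕ
columnFrom f c r zero = []
columnFrom f c r (suc k) with f r c
... | nothing = []
... | just v  = v ∷ columnFrom f c (suc r) k

lastColumn : List (List ℕ) → List ℕ
lastColumn T = columnFrom (toConfig T) (firstRowLength T ∸ 1) 0 (length T)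

{-# OPTIONS --safe #-}
-- The last column c of an SSYT is at least as far right as every row, so each of
-- its entries strictly exceeds the whole row above it.  Exposing the rightmost
-- entry of a row that reaches column c therefore finds nothing ≥ it above:
-- the loop stops at once, φ is that entry and the configuration is unchanged,
-- so the procedure reads column c off from the top.
module Submission where

open import Defs
open import Data.Nat using (ℕ; zero; suc; _≤_; _<_; _≤?_; z≤n; s≤s)
open import Data.Nat.Properties using (≤-refl; ≤-trans; <⇒≱; ≤-<-trans; ≤-pred)
open import Data.List using (List; []; _∷_; take; length; _++_)
open import Data.List.Relation.Unary.All using (All; []; _∷_)
open import Data.List.Relation.Unary.Linked using (Linked; _∷_)
open import Data.Maybe using (just; nothing)
open import Data.Product using (Σ; _×_; _,_)
open import Data.Empty using (⊥-elim)
open import Relation.Nullary using (yes; no)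
open import Relation.Binary.PropositionalEquality using (_≡_; refl; cong; sym; trans)

ColumnExceedsRowAbove : Config → ℕ → Set
ColumnExceedsRowAbove f c = ∀ r col w v → f r col ≡ just w → f (suc r) c ≡ just v → w < v

leftmostGE-nothing : ∀ f r v c k → (∀ col w → f r col ≡ just w → w < v) →
                     leftmostGE f r v c k ≡ nothing
leftmostGE-nothing f r v c zero    below = refl
leftmostGE-nothing f r v c (suc k) below with f r c in eq
... | nothing = leftmostGE-nothing f r v (suc c) k below
... | just w with v ≤? w
...   | yes v≤w = ⊥-elim (<⇒≱ (below c w eq) v≤w)
...   | no  _   = leftmostGE-nothing f r v (suc c) k below

module _ (f : Config) (c : ℕ) (dominates : ColumnExceedsRowAbove f c) where

  loop-halts : ∀ i v → f i c ≡ just v → loop (suc c) f i v ≡ (f , v)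
  loop-halts zero    v eq = refl
  loop-halts (suc r) v eq
    rewrite leftmostGE-nothing f r v 0 (suc c) (λ col w e → dominates r col w v e eq) = refl

  steps-column : ∀ i k → Σ (List ℕ) λ rest → steps (suc c) f i k ≡ columnFrom f c i k ++ rest
  steps-column i zero = [] , refl
  steps-column i (suc k) with f i c in eq
  ... | nothing = _ , refl
  ... | just v rewrite loop-halts i v eq with steps-column (suc i) k
  ...   | rest , eq′ = rest , cong (v ∷_) eq′

toConfig-suc : ∀ u T r c → toConfig (u ∷ T) (suc r) c ≡ toConfig T r c
toConfig-suc u T r c with nth T r
... | nothing = refl
... | just _  = refl

nth-just⇒< : ∀ {A : Set} (u : List A) i a → nth u i ≡ just a → i < length u
nth-just⇒< (x ∷ u) zero    a e = s≤s z≤n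
nth-just⇒< (x ∷ u) (suc i) a e = s≤s (nth-just⇒< u i a e)

nth-mono-≤ : ∀ u i j a b → Linked _≤_ u → nth u i ≡ just a → nth u j ≡ just b → i ≤ j → a ≤ b
nth-mono-≤ (x ∷ u)     zero    zero    a b _        refl refl _ = ≤-refl
nth-mono-≤ (x ∷ [])    zero    (suc j) a b _        refl ()   _
nth-mono-≤ (x ∷ y ∷ u) zero    (suc j) a b (x≤y ∷ l) refl e   _ =
  ≤-trans x≤y (nth-mono-≤ (y ∷ u) zero j y b l refl e z≤n)
nth-mono-≤ (x ∷ [])    (suc i) (suc j) a b _        ()   _    _
nth-mono-≤ (x ∷ y ∷ u) (suc i) (suc j) a b (_ ∷ l)  e₁   e₂   (s≤s i≤j) =
  nth-mono-≤ (y ∷ u) i j a b l e₁ e₂ i≤j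

StrictBelow-above : ∀ u l c v → StrictBelow u l → nth l c ≡ just v →
                    Σ ℕ λ a → (nth u c ≡ just a) × (a < v)
StrictBelow-above (a ∷ u) (b ∷ l) zero    v (a<b , _) refl = a , refl , a<b
StrictBelow-above (a ∷ u) (b ∷ l) (suc c) v (_ , sb)  e    = StrictBelow-above u l c v sb e

StrictBelow-length : ∀ u l → StrictBelow u l → length l ≤ length u
StrictBelow-length u       []      _        = z≤n
StrictBelow-length (a ∷ u) (b ∷ l) (_ , sb) = s≤s (StrictBelow-length u l sb)

row<entryBelow : ∀ u l c col w v → StrictBelow u l → Linked _≤_ u → length u ≤ suc c →
                 nth u col ≡ just w → nth l c ≡ just v → w < v
row<entryBelow u l c col w v sb sorted len ew ev with StrictBelow-above u l c v sb ev
... | a , ea , a<v = ≤-<-trans (nth-mono-≤ u col c w a sorted ew ea col≤c) a<v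
  where
  col≤c : col ≤ c
  col≤c = ≤-pred (≤-trans (nth-just⇒< u col w ew) len)

rows-length≤ : ∀ u T m → length u ≤ m → Linked StrictBelow (u ∷ T) → All (λ r → length r ≤ m) (u ∷ T)
rows-length≤ u []      m len _         = len ∷ []
rows-length≤ u (l ∷ T) m len (sb ∷ lk) =
  len ∷ rows-length≤ l T m (≤-trans (StrictBelow-length u l sb) len) lk

columnExceedsRowAbove : ∀ T c → All (λ r → length r ≤ suc c) T → Linked StrictBelow T →
                        All (Linked _≤_) T → ColumnExceedsRowAbove (toConfig T) c
columnExceedsRowAbove (u ∷ l ∷ T) c (lu ∷ _) (sb ∷ _) (su ∷ _) zero col w v ew ev =
  row<entryBelow u l c col w v sb su lu ew ev
columnExceedsRowAbove (u ∷ l ∷ T) c (_ ∷ lens) (_ ∷ lk) (_ ∷ sorted) (suc r) col w v ew ev =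
  columnExceedsRowAbove (l ∷ T) c lens lk sorted r col w v
    (trans (sym (toConfig-suc u (l ∷ T) r col)) ew)
    (trans (sym (toConfig-suc u (l ∷ T) (suc r) c)) ev)

pushDownPrefix-lastColumn : ∀ n T → IsSSYT n T → Σ (List ℕ) λ rest → pushDownPrefix T ≡ lastColumn T ++ rest
pushDownPrefix-lastColumn n []              _ = [] , refl
pushDownPrefix-lastColumn n ([] ∷ S)        s with IsSSYT.rowsNonempty s
... | nonempty ∷ _ = ⊥-elim (nonempty refl)
pushDownPrefix-lastColumn n ((a ∷ as) ∷ S) s =
  steps-column (toConfig ((a ∷ as) ∷ S)) (length as) dominates 0 (suc (length S))
  where
  dominates : ColumnExceedsRowAbove (toConfig ((a ∷ as) ∷ S)) (length as)
  dominates = columnExceedsRowAbove ((a ∷ as) ∷ S) (length as)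
    (rows-length≤ (a ∷ as) S (suc (length as)) ≤-refl (IsSSYT.colsStrict s))
    (IsSSYT.colsStrict s) (IsSSYT.rowsWeak s)

take-length-++ : ∀ {A : Set} {xs zs : List A} (ys rest : List A) →
                 xs ≡ ys ++ rest → take (length ys) (xs ++ zs) ≡ ys
take-length-++ []       rest refl = refl
take-length-++ (y ∷ ys) rest refl = cong (y ∷_) (take-length-++ ys rest refl)

proposition3p2 : (n : ℕ) (S : List (List ℕ)) → IsSSYT n S →
    take (length (lastColumn S)) (pushDown n S) ≡ lastColumn S
proposition3p2 n S s with pushDownPrefix-lastColumn n S s
... | rest , prefix≡ = take-length-++ (lastColumn S) rest prefix≡
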